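{- (1) Let $(X,A,f,\alpha)$ be an invertible micro-macro dynamical system. Then for all $a,b\in A$, $T_{a,b}(\alpha)=e^{S(a)-S(b)}\,T_{b,a}(\alpha^{ -1})$. (2) Let $(X,A,f,\alpha,r)$ be a reversible micro-macro dynamical system. Then for all $a,b\in A$, $T_{a,b}(\alpha)=e^{S(a)-S(b)}\,T_{r(b),r(a)}(\alpha)$.
   Context: A micro-macro dynamical system $(X,A,f,\alpha)$: $X,A$ finite, $f:X\to A$ surjective, $\alpha:X\to X$; invertible if $\alpha$ is bijective. Identify $a\in A$ with the block $f^{ -1}(a)\subseteq X$, $|a|=|f^{ -1}(a)|$, $S(a)=\ln|a|$. For a map $\beta:X\to X$ and nonempty subsets $U,V\subseteq X$ set $T_{U,V}(\beta)=|\{i\in V:\beta(i)\in U\}|/|V|$; in particular $T_{a,b}(\beta)$ for macrostates. A reversible system $(X,A,f,\alpha,r)$ has $\alpha$ bijective and $r:X\to X$ an involution with $r\alpha r=\alpha^{ -1}$; $r(a)$ denotes the image set $r(f^{ -1}(a))\subseteq X$ (not necessarily a block). -}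

module Defs where

open import Data.Nat using (ℕ; zero; suc)
open import Data.Integer using (+_)
open import Data.Rational using (ℚ; _/_; 0ℚ)
open import Data.Bool using (Bool; _∧_)
open import Data.Fin using (Fin)
open import Data.Fin.Properties using (_≟_; any?)
open import Data.Fin.Subset using (Subset; ∣_∣; _∈_)
open import Data.Vec using (tabulate; lookup)
open import Data.Product using (_×_; ∃)
open import Relation.Nullary using (does)
open import Relation.Binary.PropositionalEquality using (_≡_)

-- micro-macro system: X = Fin n (microstates), A = Fin m (macrostates), f : X → A

Surjective : ∀ {n m} → (Fin n → Fin m) → Set
Surjective {n} f = ∀ a → ∃ λ (i : Fin n) → f i ≡ a

block : ∀ {n m} → (Fin n → Fin m) → Fin m → Subset n
block f a = tabulate (λ i → does (f i ≟ a))

image : ∀ {n} → (Fin n → Fin n) → Subset n → Subset n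
image β U = tabulate (λ j → does (any? (λ i → (lookup U i Data.Bool.≟ Data.Bool.true) Relation.Nullary.×-dec (β i ≟ j))))
  where open import Data.Bool using (true)
        import Data.Bool

hits : ∀ {n} → (Fin n → Fin n) → Subset n → Subset n → ℕ
hits β U V = ∣ tabulate (λ i → lookup V i ∧ lookup U (β i)) ∣

-- ratio p / q as a rational (q = 0 gives 0; never used under the hypotheses)
ratio : ℕ → ℕ → ℚ
ratio p zero = 0ℚ
ratio p (suc q) = (+ p) / suc q

T : ∀ {n} → Subset n → Subset n → (Fin n → Fin n) → ℚ
T U V β = ratio (hits β U V) ∣ V ∣

size : ∀ {n m} → (Fin n → Fin m) → Fin m → ℕ
size f a = ∣ block f a ∣

-- e^{S(a) - S(b)} = e^{ln|a| - ln|b|} = |a| / |b|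
expSdiff : ∀ {n m} → (Fin n → Fin m) → Fin m → Fin m → ℚ
expSdiff f a b = ratio (size f a) (size f b)

Inverse : ∀ {n} → (Fin n → Fin n) → (Fin n → Fin n) → Set
Inverse α α⁻¹ = (∀ x → α (α⁻¹ x) ≡ x) × (∀ x → α⁻¹ (α x) ≡ x)

module Submission where

-- All quantities are finite counts.  Two facts about count drive
-- the whole argument: it respects pointwise equality, and it is invariant
-- under precomposition with a bijection (reindexing a finite sum).
--
-- (1) Reindexing by α shows hits α⁻¹ B A = hits α A B: the microstates of A
--     that α sends into B are in bijection, via α, with the microstates of B
--     that α⁻¹ sends into A.
-- (2) For a bijection σ with inverse τ, hits β (σ U) (σ V) = hits (τ β σ) U V
--     and |σ U| = |U|.  With σ = τ = r and r α r = α⁻¹ this reduces (2) to (1).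
-- Finally |a| > 0 for every block by surjectivity, and the rational identity
-- h/q = (p/q)·(h/p) for p, q > 0 turns the equality of counts into the
-- stated equality of transition probabilities.

open import Defs
open import Data.Nat using (ℕ)
open import Data.Fin using (Fin)
open import Data.Rational using (_*_)
open import Data.Product using (_×_)
open import Relation.Binary.PropositionalEquality using (_≡_)

open import Data.Nat using (zero; suc; _+_; NonZero)
open import Data.Nat.Properties using (+-0-commutativeMonoid)
open import Data.Fin using (zero; suc)
open import Data.Fin.Properties using (_≟_; any?)
open import Data.Fin.Subset using (Subset; ∣_∣)
open import Data.Fin.Permutation using (permutation)
open import Data.Bool using (Bool; true; false; _∧_)
import Data.Bool as Bool
open import Data.Bool.Properties using (∧-comm)
open import Data.Vec using (_∷_; []; tabulate; lookup)
open import Data.Vec.Functional using (removeAt)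
open import Data.Vec.Properties using (lookup∘tabulate)
open import Data.Product using (_,_)
open import Data.Integer using (+_)
open import Data.Integer.Solver using (module +-*-Solver)
open import Data.Rational using (_/_; toℚᵘ)
open import Data.Rational.Properties using (toℚᵘ-injective; toℚᵘ-homo-*; toℚᵘ-fromℚᵘ)
import Data.Rational.Unnormalised as ℚᵘ
open import Data.Rational.Unnormalised.Properties using (≃-sym; *-cong; module ≃-Reasoning)
open import Function using (_∘_)
open import Relation.Nullary using (does; _×-dec_; contradiction)
open import Relation.Unary using (Decidable)
open import Relation.Nullary.Decidable using (dec-true; dec-false)
open import Relation.Binary.PropositionalEquality
  using (refl; sym; trans; cong; cong₂; subst; _≗_; module ≡-Reasoning)
open import Algebra.Properties.CommutativeMonoid.Sum +-0-commutativeMonoid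
  using (sum; sum-cong-≗; sum-permute; sum-remove)

indicator : Bool → ℕ
indicator true  = 1
indicator false = 0

count : ∀ {n} → (Fin n → Bool) → ℕ
count g = sum (indicator ∘ g)

count-cong : ∀ {n} {g h : Fin n → Bool} → g ≗ h → count g ≡ count h
count-cong g≗h = sum-cong-≗ (cong indicator ∘ g≗h)

count-permute : ∀ {n} (g : Fin n → Bool) (σ τ : Fin n → Fin n)
  → Inverse σ τ → count (g ∘ σ) ≡ count g
count-permute g σ τ (στ , τσ) =
  sym (sum-permute (indicator ∘ g) (permutation σ τ στ τσ))

count-nonzero : ∀ {n} (g : Fin n → Bool) (i : Fin n) → g i ≡ true → NonZero (count g)
count-nonzero {suc n} g i gi≡true =
  subst NonZero (sym (sum-remove {i = i} (indicator ∘ g))) witnessed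
  where
  witnessed : NonZero (indicator (g i) + sum (removeAt (indicator ∘ g) i))
  witnessed rewrite gi≡true = _

size-as-count : ∀ {n} (U : Subset n) → ∣ U ∣ ≡ count (lookup U)
size-as-count []          = refl
size-as-count (true  ∷ U) = cong suc (size-as-count U)
size-as-count (false ∷ U) = size-as-count U

size-tabulate : ∀ {n} (g : Fin n → Bool) → ∣ tabulate g ∣ ≡ count g
size-tabulate g = trans (size-as-count (tabulate g)) (count-cong (lookup∘tabulate g))

hits-as-count : ∀ {n} (β : Fin n → Fin n) (U V : Subset n)
  → hits β U V ≡ count (λ i → lookup V i ∧ lookup U (β i))
hits-as-count β U V = size-tabulate (λ i → lookup V i ∧ lookup U (β i))

lookup-image : ∀ {n} (σ τ : Fin n → Fin n) → Inverse σ τ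
  → (U : Subset n) (j : Fin n) → lookup (image σ U) j ≡ lookup U (τ j)
lookup-image σ τ (στ , τσ) U j =
  trans (lookup∘tabulate _ j) (decide (lookup U (τ j)) refl)
  where
  open ≡-Reasoning
  preimage? : Decidable (λ i → lookup U i ≡ true × σ i ≡ j)
  preimage? i = (lookup U i Bool.≟ true) ×-dec (σ i ≟ j)
  decide : (b : Bool) → lookup U (τ j) ≡ b → does (any? preimage?) ≡ b
  decide true  Uτj≡true  = dec-true (any? preimage?) (τ j , Uτj≡true , στ j)
  decide false Uτj≡false = dec-false (any? preimage?) λ where
    (i , Ui≡true , σi≡j) → contradiction (begin
      true               ≡⟨ sym Ui≡true ⟩
      lookup U i         ≡⟨ cong (lookup U) (sym (τσ i)) ⟩
      lookup U (τ (σ i)) ≡⟨ cong (lookup U ∘ τ) σi≡j ⟩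
      lookup U (τ j)     ≡⟨ Uτj≡false ⟩
      false              ∎) λ ()

size-image : ∀ {n} (σ τ : Fin n → Fin n) → Inverse σ τ → (U : Subset n) → ∣ image σ U ∣ ≡ ∣ U ∣
size-image σ τ (στ , τσ) U = begin
  ∣ image σ U ∣              ≡⟨ size-as-count (image σ U) ⟩
  count (lookup (image σ U)) ≡⟨ count-cong (lookup-image σ τ (στ , τσ) U) ⟩
  count (lookup U ∘ τ)       ≡⟨ count-permute (lookup U) τ σ (τσ , στ) ⟩
  count (lookup U)           ≡⟨ sym (size-as-count U) ⟩
  ∣ U ∣                      ∎
  where open ≡-Reasoning

-- Time reversal of counts: i ∈ V with α i ∈ U corresponds, via j = α i, to
-- j ∈ U with α⁻¹ j ∈ V.
hits-reverse : ∀ {n} (α α⁻¹ : Fin n → Fin n) → Inverse α α⁻¹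
  → (U V : Subset n) → hits α⁻¹ V U ≡ hits α U V
hits-reverse α α⁻¹ (αα⁻¹ , α⁻¹α) U V = begin
  hits α⁻¹ V U
    ≡⟨ hits-as-count α⁻¹ V U ⟩
  count (λ j → lookup U j ∧ lookup V (α⁻¹ j))
    ≡⟨ sym (count-permute (λ j → lookup U j ∧ lookup V (α⁻¹ j)) α α⁻¹ (αα⁻¹ , α⁻¹α)) ⟩
  count (λ i → lookup U (α i) ∧ lookup V (α⁻¹ (α i)))
    ≡⟨ count-cong (λ i → cong (λ k → lookup U (α i) ∧ lookup V k) (α⁻¹α i)) ⟩
  count (λ i → lookup U (α i) ∧ lookup V i)
    ≡⟨ count-cong (λ i → ∧-comm (lookup U (α i)) (lookup V i)) ⟩
  count (λ i → lookup V i ∧ lookup U (α i))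
    ≡⟨ sym (hits-as-count α U V) ⟩
  hits α U V ∎
  where open ≡-Reasoning

hits-conjugate : ∀ {n} (σ τ : Fin n → Fin n) → Inverse σ τ
  → (β γ : Fin n → Fin n) → (∀ x → τ (β (σ x)) ≡ γ x)
  → (U V : Subset n) → hits β (image σ U) (image σ V) ≡ hits γ U V
hits-conjugate σ τ (στ , τσ) β γ τβσ≡γ U V = begin
  hits β (image σ U) (image σ V)
    ≡⟨ hits-as-count β (image σ U) (image σ V) ⟩
  count (λ j → lookup (image σ V) j ∧ lookup (image σ U) (β j))
    ≡⟨ count-cong (λ j → cong₂ _∧_ (lookup-image σ τ (στ , τσ) V j) (lookup-image σ τ (στ , τσ) U (β j))) ⟩
  count (λ j → lookup V (τ j) ∧ lookup U (τ (β j)))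
    ≡⟨ sym (count-permute (λ j → lookup V (τ j) ∧ lookup U (τ (β j))) σ τ (στ , τσ)) ⟩
  count (λ i → lookup V (τ (σ i)) ∧ lookup U (τ (β (σ i))))
    ≡⟨ count-cong (λ i → cong₂ _∧_ (cong (lookup V) (τσ i)) (cong (lookup U) (τβσ≡γ i))) ⟩
  count (λ i → lookup V i ∧ lookup U (γ i))
    ≡⟨ sym (hits-as-count γ U V) ⟩
  hits γ U V ∎
  where open ≡-Reasoning

block-nonempty : ∀ {n m} {f : Fin n → Fin m} → Surjective f → (a : Fin m) → NonZero (size f a)
block-nonempty {f = f} surjective a with surjective a
... | i , fi≡a = subst NonZero (sym (size-tabulate (λ j → does (f j ≟ a))))
                   (count-nonzero (λ j → does (f j ≟ a)) i (dec-true (f i ≟ a) fi≡a))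

ratio-chain : ∀ h {p q} → NonZero p → NonZero q → ratio h q ≡ ratio p q * ratio h p
ratio-chain h {suc p} {suc q} _ _ = toℚᵘ-injective (≃-sym (begin
  toℚᵘ (((+ suc p) / suc q) * ((+ h) / suc p))
    ≈⟨ toℚᵘ-homo-* ((+ suc p) / suc q) ((+ h) / suc p) ⟩
  toℚᵘ ((+ suc p) / suc q) ℚᵘ.* toℚᵘ ((+ h) / suc p)
    ≈⟨ *-cong (toℚᵘ-fromℚᵘ (ℚᵘ.mkℚᵘ (+ suc p) q)) (toℚᵘ-fromℚᵘ (ℚᵘ.mkℚᵘ (+ h) p)) ⟩
  ℚᵘ.mkℚᵘ (+ suc p) q ℚᵘ.* ℚᵘ.mkℚᵘ (+ h) p
    ≈⟨ ℚᵘ.*≡* (solve 3 (λ x y z → (x :* y) :* z := y :* (z :* x)) refl (+ suc p) (+ h) (+ suc q)) ⟩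
  ℚᵘ.mkℚᵘ (+ h) q
    ≈⟨ ≃-sym (toℚᵘ-fromℚᵘ (ℚᵘ.mkℚᵘ (+ h) q)) ⟩
  toℚᵘ ((+ h) / suc q) ∎))
  where
  open +-*-Solver
  open ≃-Reasoning

transition-balance : ∀ {n} (U V U′ V′ : Subset n) (β β′ : Fin n → Fin n)
  → NonZero ∣ U ∣ → NonZero ∣ V ∣ → ∣ V′ ∣ ≡ ∣ U ∣ → hits β′ U′ V′ ≡ hits β U V
  → T U V β ≡ ratio ∣ U ∣ ∣ V ∣ * T U′ V′ β′
transition-balance U V U′ V′ β β′ U≢0 V≢0 |V′|≡|U| hits′≡hits =
  trans (ratio-chain (hits β U V) U≢0 V≢0)
        (cong₂ (λ h p → ratio ∣ U ∣ ∣ V ∣ * ratio h p) (sym hits′≡hits) (sym |V′|≡|U|))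

mainTheorem6 :
    (∀ (n m : ℕ) (f : Fin n → Fin m) (α α⁻¹ : Fin n → Fin n)
       → Surjective f → Inverse α α⁻¹
       → ∀ (a b : Fin m)
       → T (block f a) (block f b) α
           ≡ expSdiff f a b * T (block f b) (block f a) α⁻¹)
    ×
    (∀ (n m : ℕ) (f : Fin n → Fin m) (α α⁻¹ r : Fin n → Fin n)
       → Surjective f → Inverse α α⁻¹
       → (∀ x → r (r x) ≡ x)
       → (∀ x → r (α (r x)) ≡ α⁻¹ x)
       → ∀ (a b : Fin m)
       → T (block f a) (block f b) α
           ≡ expSdiff f a b * T (image r (block f b)) (image r (block f a)) α)
mainTheorem6 = invertible , reversible
  where
  invertible : ∀ (n m : ℕ) (f : Fin n → Fin m) (α α⁻¹ : Fin n → Fin n)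
    → Surjective f → Inverse α α⁻¹ → ∀ (a b : Fin m)
    → T (block f a) (block f b) α ≡ expSdiff f a b * T (block f b) (block f a) α⁻¹
  invertible n m f α α⁻¹ surjective α-inverse a b =
    transition-balance (block f a) (block f b) (block f b) (block f a) α α⁻¹
      (block-nonempty surjective a) (block-nonempty surjective b) refl
      (hits-reverse α α⁻¹ α-inverse (block f a) (block f b))

  -- r is its own inverse and conjugates α to α⁻¹, so the r-images of the
  -- blocks reduce the claim to the invertible case.
  reversible : ∀ (n m : ℕ) (f : Fin n → Fin m) (α α⁻¹ r : Fin n → Fin n)
    → Surjective f → Inverse α α⁻¹ → (∀ x → r (r x) ≡ x) → (∀ x → r (α (r x)) ≡ α⁻¹ x)
    → ∀ (a b : Fin m)
    → T (block f a) (block f b) α ≡ expSdiff f a b * T (image r (block f b)) (image r (block f a)) α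
  reversible n m f α α⁻¹ r surjective α-inverse r-involution rαr≡α⁻¹ a b =
    transition-balance (block f a) (block f b) (image r (block f b)) (image r (block f a)) α α
      (block-nonempty surjective a) (block-nonempty surjective b)
      (size-image r r r-self-inverse (block f a))
      (trans (hits-conjugate r r r-self-inverse α α⁻¹ rαr≡α⁻¹ (block f b) (block f a))
             (hits-reverse α α⁻¹ α-inverse (block f a) (block f b)))
    where
    r-self-inverse : Inverse r r
    r-self-inverse = r-involution , r-involution
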